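{- Let $\sigma$ be a signature and $\Gamma\cup\{\psi\}$ a set of $\mathcal{CO}_{\sqcup}[\sigma]$-formulas. Then $\Gamma\models^c\psi$ if and only if $\Gamma\cup\{\bigsqcup_{\mathcal F\in\mathbb F_\sigma}\Phi^{\mathcal F}\}\models^g\psi$.
   Context: Signature $\sigma=(\mathrm{Dom},\mathrm{Ran})$: nonempty finite set of variables, each with nonempty finite range; $\mathrm{Ran}(\mathbf X)$ product of ranges. Assignments $s$ with $s(X)\in\mathrm{Ran}(X)$; $\mathbb A_\sigma$ their set. A system of functions $\mathcal F$ assigns to each $V\in\mathrm{En}(\mathcal F)\subseteq\mathrm{Dom}$ a set $PA_V^{\mathcal F}\subseteq\mathrm{Dom}\setminus\{V\}$ and $\mathcal F_V:\mathrm{Ran}(PA_V^{\mathcal F})\to\mathrm{Ran}(V)$; $\mathbb F_\sigma$ the finite set of all such; recursive if the graph with edges $(X,Y)$, $X\in PA_Y^{\mathcal F}$, is acyclic; $s$ compatible with $\mathcal F$ if $s(V)=\mathcal F_V(s(PA_V^{\mathcal F}))$ for $V\in\mathrm{En}(\mathcal F)$. $\mathrm{Cn}(\mathcal F)$: set of $V\in\mathrm{En}(\mathcal F)$ with $\mathcal F_V$ constant. Causal team: $(T^-,\mathcal F)$, $\mathcal F$ recursive, $T^-\subseteq\mathbb A_\sigma$ of compatible assignments; causal subteam: $(S^-,\mathcal F)$, $S^-\subseteq T^-$. Generalized causal team: a set $T$ of pairs $(s,\mathcal F)$ with $\mathcal F$ recursive and $s$ compatible; subteams are subsets; $T^-=\{s\mid(s,\mathcal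 F)\in T\}$. $\mathbf X=\mathbf x$: conjunction of equations, consistent if no variable gets two distinct values. Intervention (consistent): $\mathcal F_{\mathbf X=\mathbf x}$ = restriction of $\mathcal F$ to $\mathrm{En}(\mathcal F)\setminus\mathbf X$; $s_{\mathbf X=\mathbf x}(X_i)=x_i$, $s_{\mathbf X=\mathbf x}(V)=s(V)$ for $V\notin\mathrm{En}(\mathcal F)\cup\mathbf X$, $s_{\mathbf X=\mathbf x}(V)=\mathcal F_V(s_{\mathbf X=\mathbf x}(PA_V^{\mathcal F}))$ recursively otherwise; $T_{\mathbf X=\mathbf x}=(\{s_{\mathbf X=\mathbf x}\mid s\in T^-\},\mathcal F_{\mathbf X=\mathbf x})$ resp. $\{(s_{\mathbf X=\mathbf x},\mathcal F_{\mathbf X=\mathbf x})\mid(s,\mathcal F)\in T\}$. $\mathcal{CO}[\sigma]$: $\alpha::=X=x\mid\neg\alpha\mid\alpha\wedge\alpha\mid\alpha\vee\alpha\mid\mathbf X=\mathbf x\ \Box\!\!\rightarrow\alpha$. $\mathcal{CO}_{\sqcup}[\sigma]$: $\varphi::=X=x\mid\neg\alpha\mid\varphi\wedge\varphi\mid\varphi\vee\varphi\mid\varphi\sqcup\varphi\mid\mathbf X=\mathbf x\ \Box\!\!\rightarrow\varphi$, $\alpha\in\mathcal{CO}[\sigma]$. $\alpha\supset\varphi:=\neg\alpha\vee\varphi$. Causal-team semantics $\models^c$: $T\models X=x$ iff $s(X)=x$ for all $s\in T^-$; $T\models\neg\alpha$ iff $(\{s\},\mathcal F)\not\models\alpha$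 for all $s\in T^-$; $\wedge$ usual; $T\models\varphi\vee\psi$ iff causal subteams $T_1,T_2$ with $T_1^-\cup T_2^-=T^-$, $T_1\models\varphi$, $T_2\models\psi$ exist; $T\models\varphi\sqcup\psi$ iff $T\models\varphi$ or $T\models\psi$; $T\models\mathbf X=\mathbf x\ \Box\!\!\rightarrow\varphi$ iff inconsistent or $T_{\mathbf X=\mathbf x}\models\varphi$. Generalized semantics $\models^g$: same, except $T\models\neg\alpha$ iff $\{(s,\mathcal F)\}\not\models\alpha$ for all $(s,\mathcal F)\in T$, and $T\models\varphi\vee\psi$ iff $T=T_1\cup T_2$ with $T_1\models\varphi$, $T_2\models\psi$. $\Gamma\models^c\psi$ (resp. $\models^g$): every causal team (resp. generalized causal team) over $\sigma$ satisfying all of $\Gamma$ satisfies $\psi$. $\Phi^{\mathcal F}:=\bigwedge_{V\in\mathrm{En}(\mathcal F)}\eta(V)\wedge\bigwedge_{V\in(\mathrm{Dom}\setminus\mathrm{En}(\mathcal F))\cup\mathrm{Cn}(\mathcal F)}\xi(V)$, with $\eta(V):=\bigwedge\{(\mathbf W=\mathbf w\wedge PA_V^{\mathcal F}=\mathbf p)\ \Box\!\!\rightarrow V=\mathcal F_V(\mathbf p)\mid\mathbf W=\mathrm{Dom}\setminus(PA_V^{\mathcal F}\cup\{V\}),\mathbf w\in\mathrm{Ran}(\mathbf W),\mathbf p\in\mathrm{Ran}(PA_V^{\mathcal F})\}$ and $\xi(V):=\bigwedge\{V=v\supset(\mathbf W_V=\mathbf w\ \Box\!\!\rightarrow V=v)\mid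 v\in\mathrm{Ran}(V),\mathbf W_V=\mathrm{Dom}\setminus\{V\},\mathbf w\in\mathrm{Ran}(\mathbf W_V)\}$; $\bigsqcup$ is iterated $\sqcup$. -}

module Defs where

open import Level using (Level) renaming (suc to lsuc)
open import Data.Nat using (ℕ; zero; suc)
open import Data.Bool using (Bool; true; false; _∨_)
open import Data.Unit using (⊤; tt)
open import Data.Empty using (⊥)
open import Data.Fin using (Fin; zero; suc; _≟_)
open import Data.Fin.Subset using (Subset; _∈_; _∉_)
open import Data.List using (List; []; _∷_; length; lookup; map; filter; allFin)
open import Data.List.NonEmpty using (List⁺; toList)
import Data.List.Membership.Propositional as LM
open import Data.Vec using (Vec; []; _∷_)
open import Data.Maybe using (Maybe; just; nothing)
open import Data.Product using (Σ; _×_; _,_; proj₁; proj₂)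
open import Data.Sum using (_⊎_)
open import Relation.Nullary using (¬_; ⌊_⌋; ¬?)
open import Relation.Binary.PropositionalEquality using (_≡_)
open import Relation.Binary.Construct.Closure.Transitive using (TransClosure)

Tup : List ℕ → Set
Tup []       = ⊤
Tup (r ∷ rs) = Fin (suc r) × Tup rs

get : {rs : List ℕ} → Tup rs → (X : Fin (length rs)) → Fin (suc (lookup rs X))
get {r ∷ rs} (v , t) zero    = v
get {r ∷ rs} (v , t) (suc X) = get t X

-- Ran(P) for a set P of variables: tuples of values of the variables in P.
RanS : (rs : List ℕ) → Vec Bool (length rs) → Set
RanS []       []          = ⊤
RanS (r ∷ rs) (true ∷ b)  = Fin (suc r) × RanS rs b
RanS (r ∷ rs) (false ∷ b) = RanS rs b

restr : {rs : List ℕ} (b : Vec Bool (length rs)) → Tup rs → RanS rs b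
restr {[]}     []          t       = tt
restr {r ∷ rs} (true ∷ b)  (v , t) = v , restr b t
restr {r ∷ rs} (false ∷ b) (v , t) = restr b t

-- Signatures: a nonempty list of range codes; variable i has range
-- Fin (suc (code i)), so every range is nonempty and finite.

Sig : Set
Sig = List⁺ ℕ

module _ (σ : Sig) where

  rs : List ℕ
  rs = toList σ

  N : ℕ
  N = length rs

  Var : Set
  Var = Fin N

  Val : Var → Set
  Val X = Fin (suc (lookup rs X))

  Assign : Set
  Assign = Tup rs

  -- the datum (PA_V, F_V) attached to an endogenous variable V
  record FunAt (V : Var) : Set where
    field
      pa  : Subset N
      irr : V ∉ pa
      fn  : RanS rs pa → Val V
  open FunAt public

  -- systems of functions: En(F) = {V | F V ≠ nothing}
  Sys : Set
  Sys = (V : Var) → Maybe (FunAt V)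

  Edge : Sys → Var → Var → Set
  Edge F X Y = Σ (FunAt Y) λ fa → (F Y ≡ just fa) × (X ∈ pa fa)

  Recursive : Sys → Set
  Recursive F = ∀ X → ¬ TransClosure (Edge F) X X

  Compatible : Sys → Assign → Set
  Compatible F s = ∀ V fa → F V ≡ just fa → get s V ≡ fn fa (restr (pa fa) s)

  Constant : {V : Var} → FunAt V → Set
  Constant fa = ∀ p q → fn fa p ≡ fn fa q

  Intv : Set
  Intv = List (Σ Var Val)

  data CO : Set where
    eqC  : (X : Var) → Val X → CO
    negC : CO → CO
    andC : CO → CO → CO
    orC  : CO → CO → CO
    cfC  : Intv → CO → CO

  data COsq : Set where
    eq   : (X : Var) → Val X → COsq
    neg  : CO → COsq
    and  : COsq → COsq → COsq
    or   : COsq → COsq → COsq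
    sq   : COsq → COsq → COsq
    cf   : Intv → COsq → COsq

  Consistent : Intv → Set
  Consistent xs = ∀ X x x' → (X , x) LM.∈ xs → (X , x') LM.∈ xs → x ≡ x'

  inDom : Var → Intv → Bool
  inDom V []             = false
  inDom V ((X , _) ∷ xs) = ⌊ X ≟ V ⌋ ∨ inDom V xs

  restrictF : Sys → Intv → Sys
  restrictF F xs V with inDom V xs
  ... | true  = nothing
  ... | false = F V

  IsIntv : Sys → Assign → Intv → Assign → Set
  IsIntv F s xs t =
    (∀ X x → (X , x) LM.∈ xs → get t X ≡ x) ×
    (∀ V → inDom V xs ≡ false →
       (F V ≡ nothing → get t V ≡ get s V) ×
       (∀ fa → F V ≡ just fa → get t V ≡ fn fa (restr (pa fa) t)))

  Lift₁ : Set → Set₁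
  Lift₁ A = Level.Lift (lsuc Level.zero) A

  CTeam : Set₁
  CTeam = Assign → Set

  _⊆_ : {A : Set} → (A → Set) → (A → Set) → Set
  P ⊆ Q = ∀ a → P a → Q a

  IsUnion : {A : Set} → (A → Set) → (A → Set) → (A → Set) → Set
  IsUnion T T₁ T₂ = (T₁ ⊆ T) × (T₂ ⊆ T) × (∀ a → T a → T₁ a ⊎ T₂ a)

  imgC : Sys → Intv → CTeam → CTeam
  imgC F xs T t = Σ Assign λ s → T s × IsIntv F s xs t

  satCO : Sys → CTeam → CO → Set₁
  satCO F T (eqC X x)   = Lift₁ (∀ s → T s → get s X ≡ x)
  satCO F T (negC α)    = ∀ s → T s → ¬ satCO F (λ t → t ≡ s) α
  satCO F T (andC α β)  = satCO F T α × satCO F T β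
  satCO F T (orC α β)   = Σ CTeam λ T₁ → Σ CTeam λ T₂ →
                            Lift₁ (IsUnion T T₁ T₂) × satCO F T₁ α × satCO F T₂ β
  satCO F T (cfC xs α)  = Lift₁ (¬ Consistent xs) ⊎ satCO (restrictF F xs) (imgC F xs T) α

  satC : Sys → CTeam → COsq → Set₁
  satC F T (eq X x)   = Lift₁ (∀ s → T s → get s X ≡ x)
  satC F T (neg α)    = ∀ s → T s → ¬ satCO F (λ t → t ≡ s) α
  satC F T (and φ ψ)  = satC F T φ × satC F T ψ
  satC F T (or φ ψ)   = Σ CTeam λ T₁ → Σ CTeam λ T₂ →
                          Lift₁ (IsUnion T T₁ T₂) × satC F T₁ φ × satC F T₂ ψ
  satC F T (sq φ ψ)   = satC F T φ ⊎ satC F T ψ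
  satC F T (cf xs φ)  = Lift₁ (¬ Consistent xs) ⊎ satC (restrictF F xs) (imgC F xs T) φ

  GTeam : Set₁
  GTeam = Assign × Sys → Set

  imgG : Intv → GTeam → GTeam
  imgG xs T (t , G) = Σ Assign λ s → Σ Sys λ F →
                        T (s , F) × (G ≡ restrictF F xs) × IsIntv F s xs t

  satCOg : GTeam → CO → Set₁
  satCOg T (eqC X x)   = Lift₁ (∀ s F → T (s , F) → get s X ≡ x)
  satCOg T (negC α)    = ∀ s F → T (s , F) → ¬ satCOg (λ q → q ≡ (s , F)) α
  satCOg T (andC α β)  = satCOg T α × satCOg T β
  satCOg T (orC α β)   = Σ GTeam λ T₁ → Σ GTeam λ T₂ →
                           Lift₁ (IsUnion T T₁ T₂) × satCOg T₁ α × satCOg T₂ β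
  satCOg T (cfC xs α)  = Lift₁ (¬ Consistent xs) ⊎ satCOg (imgG xs T) α

  satG : GTeam → COsq → Set₁
  satG T (eq X x)   = Lift₁ (∀ s F → T (s , F) → get s X ≡ x)
  satG T (neg α)    = ∀ s F → T (s , F) → ¬ satCOg (λ q → q ≡ (s , F)) α
  satG T (and φ ψ)  = satG T φ × satG T ψ
  satG T (or φ ψ)   = Σ GTeam λ T₁ → Σ GTeam λ T₂ →
                        Lift₁ (IsUnion T T₁ T₂) × satG T₁ φ × satG T₂ ψ
  satG T (sq φ ψ)   = satG T φ ⊎ satG T ψ
  satG T (cf xs φ)  = Lift₁ (¬ Consistent xs) ⊎ satG (imgG xs T) φ

  -- The formula Φ^F.
  -- others V u : the intervention W_V = w, i.e. every variable other
  -- than V set to its value in u (u ranges over all assignments, so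
  -- (u restricted to Dom \ {V}) ranges over all of Ran(Dom \ {V})).

  others : Var → Assign → Intv
  others V u = map (λ Y → (Y , get u Y)) (filter (λ Y → ¬? (Y ≟ V)) (allFin N))

  -- conjunct of η(V) for the values (w , p) given by u
  etaConj : (V : Var) → FunAt V → Assign → COsq
  etaConj V fa u = cf (others V u) (eq V (fn fa (restr (pa fa) u)))

  -- conjunct of ξ(V):  V = v ⊃ (W_V = w □→ V = v)
  xiConj : (V : Var) → Val V → Assign → COsq
  xiConj V v u = or (neg (eqC V v)) (cf (others V u) (eq V v))

  -- T ⊨g Φ^F : every conjunct of η(V) (V ∈ En F) and of ξ(V)
  -- (V ∈ (Dom \ En F) ∪ Cn F) holds in T.
  SatPhiG : Sys → GTeam → Set₁
  SatPhiG F T = ∀ V →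
    (∀ fa → F V ≡ just fa → ∀ u → satG T (etaConj V fa u)) ×
    ((F V ≡ nothing ⊎ (Σ (FunAt V) λ fa → (F V ≡ just fa) × Constant fa)) →
       ∀ v u → satG T (xiConj V v u))

  SatBigPhiG : GTeam → Set₁
  SatBigPhiG T = Σ Sys λ F → SatPhiG F T

  IsCausalTeam : Sys → CTeam → Set
  IsCausalTeam F T = Recursive F × (∀ s → T s → Compatible F s)

  IsGenTeam : GTeam → Set
  IsGenTeam T = ∀ s F → T (s , F) → Recursive F × Compatible F s

  EntC : (COsq → Set) → COsq → Set₁
  EntC Γ ψ = ∀ (F : Sys) (T : CTeam) → IsCausalTeam F T →
             (∀ γ → Γ γ → satC F T γ) → satC F T ψ

  EntGPhi : (COsq → Set) → COsq → Set₁
  EntGPhi Γ ψ = ∀ (T : GTeam) → IsGenTeam T →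
                (∀ γ → Γ γ → satG T γ) → SatBigPhiG T → satG T ψ

module Submission where

-- Both directions rest on a transfer theorem.  A causal team (G, T*) and a
-- generalized team T correspond when they contain the same assignments and every
-- pair (s, F) ∈ T is good for G: F and G are compatible with s, agree extensionally
-- where both define a variable, and where only one does, its function is constant.
-- Such systems produce the same interventions, so corresponding teams satisfy the
-- same CO⊔-formulas (transfer-C).
--   (⇐)  A causal team (F, T) corresponds to {(s, F) | s ∈ T}, which satisfies Φ^F.
--   (⇒)  If T satisfies Φ^F, the η- and ξ-conjuncts force every (s, F') ∈ T to respond
--        to the interventions W_V = w exactly like F, hence to be good for the
--        minimisation F₀ of F (each parent set cut down to the variables the function
--        really depends on).  Every edge of F₀ is then an edge of each F', so either
--        F₀ is recursive and T corresponds to (F₀, T⁻), or T is empty and satisfies ψ.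

open import Level using (lift)
open import Data.Nat using (ℕ; zero; suc; s≤s)
open import Data.Nat.Properties using (n<1+n)
open import Data.Bool using (Bool; true; false; not)
open import Data.Unit using (⊤; tt)
open import Data.Empty using (⊥-elim)
open import Data.Fin using (Fin; zero; suc; _≟_; _<_)
open import Data.Fin.Properties using (any?; all?; pigeonhole)
open import Data.Fin.Subset using (Subset; _∈_)
open import Data.Fin.Subset.Properties using (_∈?_)
open import Data.List using (List; []; _∷_; length; lookup; allFin)
open import Data.List.Relation.Unary.Any using (here; there)
import Data.List.Membership.Propositional as List
open import Data.List.Membership.Propositional.Properties
  using (∈-map⁺; ∈-map⁻; ∈-filter⁺; ∈-filter⁻; ∈-allFin)
open import Data.Vec using ([]; _∷_; tabulate; here; there)
open import Data.Vec.Properties using (lookup∘tabulate; []=⇒lookup; lookup⇒[]=)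
open import Data.Maybe using (Maybe; just; nothing)
open import Data.Product using (Σ; _×_; _,_; proj₁; proj₂)
open import Data.Product.Function.NonDependent.Propositional using (_×-⇔_)
open import Data.Sum using (_⊎_; inj₁; inj₂; map) renaming ([_,_] to either)
open import Data.Sum.Function.Propositional using (_⊎-⇔_)
open import Function.Bundles using (_⇔_; mk⇔; module Equivalence)
open import Function.Construct.Identity using (⇔-id)
open import Relation.Nullary using (¬_; Dec; yes; no; ⌊_⌋; ¬?)
open import Relation.Nullary.Decidable using (map′; _×-dec_)
open import Relation.Binary.PropositionalEquality using (_≡_; refl; sym; trans; cong; cong₂; subst)
open import Relation.Binary.Construct.Closure.Transitive using (TransClosure; [_]; _∷_)
open import Defs

open Equivalence using (to; from)

set : {ls : List ℕ} → Tup ls → (X : Fin (length ls)) → Fin (suc (lookup ls X)) → Tup ls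
set {r ∷ ls} (v , t) zero    a = a , t
set {r ∷ ls} (v , t) (suc X) a = v , set t X a

get-set-same : {ls : List ℕ} (t : Tup ls) → ∀ X a → get (set t X a) X ≡ a
get-set-same {r ∷ ls} (v , t) zero    a = refl
get-set-same {r ∷ ls} (v , t) (suc X) a = get-set-same t X a

get-set-other : {ls : List ℕ} (t : Tup ls) → ∀ X a Y → ¬ X ≡ Y → get (set t X a) Y ≡ get t Y
get-set-other {r ∷ ls} (v , t) zero    a zero    X≢Y = ⊥-elim (X≢Y refl)
get-set-other {r ∷ ls} (v , t) zero    a (suc Y) X≢Y = refl
get-set-other {r ∷ ls} (v , t) (suc X) a zero    X≢Y = refl
get-set-other {r ∷ ls} (v , t) (suc X) a (suc Y) X≢Y = get-set-other t X a Y (λ e → X≢Y (cong suc e))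

restr-cong : {ls : List ℕ} (P : Subset (length ls)) (t u : Tup ls) →
             (∀ X → X ∈ P → get t X ≡ get u X) → restr {ls} P t ≡ restr {ls} P u
restr-cong {[]}     []          t       u       same = refl
restr-cong {r ∷ ls} (true ∷ P)  (v , t) (w , u) same =
  cong₂ _,_ (same zero here) (restr-cong {ls} P t u (λ X X∈P → same (suc X) (there X∈P)))
restr-cong {r ∷ ls} (false ∷ P) (v , t) (w , u) same =
  restr-cong {ls} P t u (λ X X∈P → same (suc X) (there X∈P))

fill : {ls : List ℕ} (P : Subset (length ls)) → RanS ls P → Tup ls
fill {[]}     []          p       = tt
fill {r ∷ ls} (true ∷ P)  (v , p) = v , fill P p
fill {r ∷ ls} (false ∷ P) p       = zero , fill P p

get-fill : {ls : List ℕ} (P : Subset (length ls)) (u : Tup ls) → ∀ Y →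
           Y ∈ P → get (fill {ls} P (restr {ls} P u)) Y ≡ get u Y
get-fill {r ∷ ls} (true ∷ P)  (v , u) zero    here      = refl
get-fill {r ∷ ls} (true ∷ P)  (v , u) (suc Y) (there m) = get-fill {ls} P u Y m
get-fill {r ∷ ls} (false ∷ P) (v , u) (suc Y) (there m) = get-fill {ls} P u Y m

all-tuples? : {ls : List ℕ} (Q : Tup ls → Set) → (∀ t → Dec (Q t)) → Dec (∀ t → Q t)
all-tuples? {[]} Q Q? with Q? tt
... | yes q = yes (λ { tt → q })
... | no ¬q = no (λ h → ¬q (h tt))
all-tuples? {r ∷ ls} Q Q? =
  map′ (λ h → λ { (v , t) → h v t }) (λ h v t → h (v , t))
       (all? (λ v → all-tuples? (λ t → Q (v , t)) (λ t → Q? (v , t))))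

module _ {ls : List ℕ} {m : ℕ} where

  Indep : (Tup ls → Fin m) → Fin (length ls) → Set
  Indep f Y = ∀ u a → f u ≡ f (set u Y a)

  Indep? : ∀ f Y → Dec (Indep f Y)
  Indep? f Y = all-tuples? _ (λ u → all? (λ a → f u ≟ f (set u Y a)))

agree-on-dependent : {ls : List ℕ} {m : ℕ} (f : Tup ls → Fin m) (u u' : Tup ls) →
                     (∀ Y → Indep f Y ⊎ get u Y ≡ get u' Y) → f u ≡ f u'
agree-on-dependent {[]}     f tt      tt        same = refl
agree-on-dependent {r ∷ ls} f (v , t) (v' , t') same =
  trans head (agree-on-dependent (λ x → f (v' , x)) t t'
               (λ Y → map (λ ind x a → ind (v' , x) a) (λ e → e) (same (suc Y))))
  where
  head : f (v , t) ≡ f (v' , t)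
  head with same zero
  ... | inj₁ ind = ind (v , t) v'
  ... | inj₂ e   = cong (λ z → f (z , t)) e

module Acyclicity {n : ℕ} (E : Fin n → Fin n → Set) (E? : ∀ x y → Dec (E x y)) where

  Walk : ℕ → Fin n → Set
  Walk zero    x = ⊤
  Walk (suc k) x = Σ (Fin n) λ z → E x z × Walk k z

  walk? : ∀ k x → Dec (Walk k x)
  walk? zero    x = yes tt
  walk? (suc k) x = any? (λ z → E? x z ×-dec walk? k z)

  cycle-walk : ∀ {a x} → TransClosure E a x → TransClosure E x x → ∀ k → Walk k a
  cycle-walk p               c zero    = tt
  cycle-walk {x = x} [ e ]   c (suc k) = x , e , cycle-walk c c k
  cycle-walk         (e ∷ p) c (suc k) = _ , e , cycle-walk p c k

  vertex : ∀ {k x} → Walk k x → Fin (suc k) → Fin n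
  vertex {x = x}   w           zero    = x
  vertex {suc k}   (z , e , w) (suc i) = vertex w i

  reach : ∀ {k x} (w : Walk (suc k) x) j → TransClosure E x (vertex w (suc j))
  reach           (z , e , w) zero    = [ e ]
  reach {suc k}   (z , e , w) (suc j) = e ∷ reach w j

  path : ∀ {k x} (w : Walk k x) {i j} → i < j → TransClosure E (vertex w i) (vertex w j)
  path {suc k} w           {zero}  {suc j} _         = reach w j
  path {suc k} (z , e , w) {suc i} {suc j} (s≤s i<j) = path w i<j

  -- A walk with n steps visits n + 1 vertices, so it repeats one: a cycle.
  long-walk-cycle : ∀ {x} → Walk n x → Σ (Fin n) λ y → TransClosure E y y
  long-walk-cycle w with pigeonhole (n<1+n n) (vertex w)
  ... | i , j , i<j , same = vertex w j , subst (λ y → TransClosure E y (vertex w j)) same (path w i<j)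

  acyclic? : (∀ x → ¬ TransClosure E x x) ⊎ (Σ (Fin n) λ x → TransClosure E x x)
  acyclic? with any? (walk? n)
  ... | yes (x , w) = inj₂ (long-walk-cycle w)
  ... | no ¬w       = inj₁ (λ x c → ¬w (x , cycle-walk c c n))

∈-tabulate⁻ : {n : ℕ} (f : Fin n → Bool) {X : Fin n} → X ∈ tabulate f → f X ≡ true
∈-tabulate⁻ f {X} X∈ = trans (sym (lookup∘tabulate f X)) ([]=⇒lookup X∈)

∈-tabulate⁺ : {n : ℕ} (f : Fin n → Bool) {X : Fin n} → f X ≡ true → X ∈ tabulate f
∈-tabulate⁺ f {X} e = lookup⇒[]= X (tabulate f) (trans (lookup∘tabulate f X) e)

tc-map : {A : Set} {E E' : A → A → Set} → (∀ {x y} → E x y → E' x y) →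
         ∀ {x y} → TransClosure E x y → TransClosure E' x y
tc-map f [ e ]   = [ f e ]
tc-map f (e ∷ p) = f e ∷ tc-map f p

module _ (σ : Sig) where

  private variable
    V X Y : Var σ
    s t u : Assign σ
    F G : Sys σ
    T* : CTeam σ
    T : GTeam σ
    xs : Intv σ

  eval : FunAt σ V → Assign σ → Val σ V
  eval fa u = fn fa (restr (pa fa) u)

  eval-local : (fa : FunAt σ V) → (∀ Y → Y ∈ pa fa → get t Y ≡ get u Y) → eval fa t ≡ eval fa u
  eval-local {t = t} {u = u} fa same = cong (fn fa) (restr-cong {rs σ} (pa fa) t u same)

  eval-indep : (fa : FunAt σ V) → ¬ X ∈ pa fa → Indep (eval fa) X
  eval-indep {X = X} fa X∉ u a =
    eval-local fa (λ Y Y∈ → sym (get-set-other u X a Y (λ { refl → X∉ Y∈ })))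

  -- in particular V is never a parent of itself
  eval-set-self : (fa : FunAt σ V) → ∀ u a → eval fa (set u V a) ≡ eval fa u
  eval-set-self fa u a = sym (eval-indep fa (irr fa) u a)

  others-member : ∀ {x : Val σ X} → (X , x) List.∈ others σ V u → ¬ X ≡ V × x ≡ get u X
  others-member {V = V} {u = u} mem with ∈-map⁻ (λ Y → (Y , get u Y)) mem
  ... | Y , Y∈ , refl = proj₂ (∈-filter⁻ (λ Y → ¬? (Y ≟ V)) {xs = allFin (N σ)} Y∈) , refl

  others-consistent : ∀ V u → Consistent σ (others σ V u)
  others-consistent V u X x x' m m' =
    trans (proj₂ (others-member {V = V} {u = u} m)) (sym (proj₂ (others-member {V = V} {u = u} m')))

  others-complete : ∀ u → ¬ X ≡ V → (X , get u X) List.∈ others σ V u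
  others-complete {X = X} {V = V} u X≢V =
    ∈-map⁺ (λ Y → (Y , get u Y)) (∈-filter⁺ (λ Y → ¬? (Y ≟ V)) (∈-allFin X) X≢V)

  inDom-sound : ∀ xs → inDom σ V xs ≡ true → Σ (Val σ V) λ x → (V , x) List.∈ xs
  inDom-sound {V = V} ((Y , y) ∷ xs) e with Y ≟ V
  ... | yes refl = y , here refl
  ... | no _     = let (x , m) = inDom-sound xs e in x , there m

  inDom-complete : ∀ {x : Val σ X} xs → (X , x) List.∈ xs → inDom σ X xs ≡ true
  inDom-complete {X = X} ((Y , y) ∷ xs) (here refl) with X ≟ X
  ... | yes _  = refl
  ... | no X≢X = ⊥-elim (X≢X refl)
  inDom-complete {X = X} ((Y , y) ∷ xs) (there m) with Y ≟ X
  ... | yes _ = refl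
  ... | no _  = inDom-complete xs m

  others-free-self : ∀ V u → inDom σ V (others σ V u) ≡ false
  others-free-self V u with inDom σ V (others σ V u) in e
  ... | true  = ⊥-elim (proj₁ (others-member {V = V} {u = u} (proj₂ (inDom-sound _ e))) refl)
  ... | false = refl

  others-free-only : ∀ V u Y → inDom σ Y (others σ V u) ≡ false → Y ≡ V
  others-free-only V u Y e with Y ≟ V
  ... | yes Y≡V = Y≡V
  ... | no Y≢V with trans (sym (inDom-complete (others σ V u) (others-complete {V = V} u Y≢V))) e
  ...   | ()

  intervened-others : IsIntv σ F s (others σ V u) t → ∀ Y → ¬ Y ≡ V → get t Y ≡ get u Y
  intervened-others {V = V} {u = u} (set-vars , _) Y Y≢V = set-vars Y _ (others-complete {V = V} u Y≢V)

  -- ... so the mechanism of V sees the same parents after the intervention as in u.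
  eval-after-others : (fa : FunAt σ V) → IsIntv σ F s (others σ V u) t → eval fa t ≡ eval fa u
  eval-after-others {V = V} {u = u} fa iv =
    eval-local fa (λ Y Y∈ → intervened-others {V = V} {u = u} iv Y (λ { refl → irr fa Y∈ }))

  AgreeAt : Maybe (FunAt σ V) → Maybe (FunAt σ V) → Set
  AgreeAt nothing  nothing  = ⊤
  AgreeAt (just a) (just b) = ∀ u → eval a u ≡ eval b u
  AgreeAt nothing  (just b) = ∀ u u' → eval b u ≡ eval b u'
  AgreeAt (just a) nothing  = ∀ u u' → eval a u ≡ eval a u'

  Agree : Sys σ → Sys σ → Set
  Agree F G = ∀ V → AgreeAt (F V) (G V)

  agreeAt-refl : (m : Maybe (FunAt σ V)) → AgreeAt m m
  agreeAt-refl nothing  = tt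
  agreeAt-refl (just a) = λ u → refl

  agreeAt-sym : (m m' : Maybe (FunAt σ V)) → AgreeAt m m' → AgreeAt m' m
  agreeAt-sym nothing  nothing  ag = tt
  agreeAt-sym (just a) (just b) ag = λ u → sym (ag u)
  agreeAt-sym nothing  (just b) ag = ag
  agreeAt-sym (just a) nothing  ag = ag

  agree-sym : Agree F G → Agree G F
  agree-sym {F} {G} ag V = agreeAt-sym (F V) (G V) (ag V)

  CompatAt : Maybe (FunAt σ V) → Assign σ → Set
  CompatAt {V} m s = ∀ fa → m ≡ just fa → get s V ≡ eval fa s

  IntvAt : Maybe (FunAt σ V) → Assign σ → Assign σ → Set
  IntvAt {V} m s t = (m ≡ nothing → get t V ≡ get s V) × (∀ fa → m ≡ just fa → get t V ≡ eval fa t)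

  intvAt-transport : (m m' : Maybe (FunAt σ V)) → AgreeAt m m' → CompatAt m s → CompatAt m' s →
                     IntvAt m s t → IntvAt m' s t
  intvAt-transport nothing  nothing  ag c c' h = h
  intvAt-transport (just a) (just b) ag c c' (_ , h) = (λ ()) , λ { b refl → trans (h a refl) (ag _) }
  intvAt-transport {s = s} {t = t} nothing (just b) ag c c' (h , _) =
    (λ ()) , λ { b refl → trans (h refl) (trans (c' b refl) (ag s t)) }
  intvAt-transport {s = s} {t = t} (just a) nothing ag c c' (_ , h) =
    (λ _ → trans (h a refl) (trans (ag t s) (sym (c a refl)))) , λ _ ()

  intervention-transport : Compatible σ F s → Compatible σ G s → Agree F G →
                           IsIntv σ F s xs t → IsIntv σ G s xs t
  intervention-transport {F = F} {G = G} cF cG ag (set-vars , free-vars) =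
    set-vars , λ V free → intvAt-transport (F V) (G V) (ag V) (cF V) (cG V) (free-vars V free)

  compatible-after-intervention : IsIntv σ F s xs t → Compatible σ (restrictF σ F xs) t
  compatible-after-intervention {xs = xs} (_ , free-vars) V fa e with inDom σ V xs in free
  compatible-after-intervention (_ , free-vars) V fa () | true
  ... | false = proj₂ (free-vars V free) fa e

  agree-restrict : Agree F G → Agree (restrictF σ F xs) (restrictF σ G xs)
  agree-restrict {xs = xs} ag V with inDom σ V xs
  ... | true  = tt
  ... | false = ag V

  -- (s , F) can stand for s in a causal team with system G.
  Good : Assign σ → Sys σ → Sys σ → Set
  Good s F G = Compatible σ F s × Compatible σ G s × Agree F G

  assignments : GTeam σ → CTeam σ
  assignments T s = Σ (Sys σ) λ F → T (s , F)

  Corr : Sys σ → CTeam σ → GTeam σ → Set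
  Corr G T* T = (∀ s F → T (s , F) → T* s × Good s F G) × (∀ s → T* s → assignments T s)

  corr-singleton : Good s F G → Corr G (λ t → t ≡ s) (λ q → q ≡ (s , F))
  corr-singleton {F = F} good = (λ { _ _ refl → refl , good }) , (λ { _ refl → F , refl })

  corr-restrict : (S : CTeam σ) → Corr G T* T → _⊆_ σ S T* → Corr G S (λ q → T q × S (proj₁ q))
  corr-restrict S (into , onto) S⊆T* =
    (λ s F (m , m') → m' , proj₂ (into s F m)) ,
    (λ s m' → let (F , m) = onto s (S⊆T* s m') in F , m , m')

  corr-subteam : (T₁ : GTeam σ) → Corr G T* T → _⊆_ σ T₁ T → Corr G (assignments T₁) T₁
  corr-subteam T₁ (into , onto) T₁⊆T = (λ s F m → (F , m) , proj₂ (into s F (T₁⊆T _ m))) , (λ s m → m)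

  corr-intervention : Corr G T* T → Corr (restrictF σ G xs) (imgC σ G xs T*) (imgG σ xs T)
  corr-intervention {G = G} {T* = T*} {T = T} {xs = xs} (into , onto) = into′ , onto′
    where
    into′ : ∀ t F' → imgG σ xs T (t , F') → imgC σ G xs T* t × Good t F' (restrictF σ G xs)
    into′ t _ (s , F , m , refl , iv) with into s F m
    ... | m* , cF , cG , ag =
      (s , m* , iv′) , compatible-after-intervention iv , compatible-after-intervention iv′ ,
      agree-restrict {xs = xs} ag
      where
      iv′ : IsIntv σ G s xs t
      iv′ = intervention-transport cF cG ag iv
    onto′ : ∀ t → imgC σ G xs T* t → assignments (imgG σ xs T) t
    onto′ t (s , m* , iv) with onto s m*
    ... | F , m with into s F m
    ...   | _ , cF , cG , ag =
      restrictF σ F xs , s , F , m , refl , intervention-transport cG cF (agree-sym ag) iv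

  transfer-all : Corr G T* T → (P : Assign σ → Set) →
                 Lift₁ σ (∀ s → T* s → P s) ⇔ Lift₁ σ (∀ s F → T (s , F) → P s)
  transfer-all (into , onto) P = mk⇔
    (λ { (lift h) → lift (λ s F m → h s (proj₁ (into s F m))) })
    (λ { (lift h) → lift (λ s m* → h s (proj₁ (onto s m*)) (proj₂ (onto s m*))) })

  transfer-neg : {A : Assign σ → Set₁} {B : Assign σ → Sys σ → Set₁} →
                 (∀ s F → Good s F G → A s ⇔ B s F) → Corr G T* T →
                 (∀ s → T* s → ¬ A s) ⇔ (∀ s F → T (s , F) → ¬ B s F)
  transfer-neg ih (into , onto) = mk⇔
    (λ h s F m b → h s (proj₁ (into s F m)) (from (ih s F (proj₂ (into s F m))) b))
    (λ h s m* a → let (F , m) = onto s m* in h s F m (to (ih s F (proj₂ (into s F m))) a))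

  transfer-split : {A₁ A₂ : CTeam σ → Set₁} {B₁ B₂ : GTeam σ → Set₁} →
    (∀ T* T → Corr G T* T → A₁ T* ⇔ B₁ T) → (∀ T* T → Corr G T* T → A₂ T* ⇔ B₂ T) →
    Corr G T* T →
    (Σ (CTeam σ) λ T₁ → Σ (CTeam σ) λ T₂ → Lift₁ σ (IsUnion σ T* T₁ T₂) × A₁ T₁ × A₂ T₂) ⇔
    (Σ (GTeam σ) λ T₁ → Σ (GTeam σ) λ T₂ → Lift₁ σ (IsUnion σ T T₁ T₂) × B₁ T₁ × B₂ T₂)
  transfer-split {T = T} ih₁ ih₂ R@(into , onto) = mk⇔
    (λ { (S₁ , S₂ , lift (S₁⊆ , S₂⊆ , cover) , a₁ , a₂) →
         part S₁ , part S₂ ,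
         lift ((λ _ → proj₁) , (λ _ → proj₁) ,
               λ { (s , F) m → map (m ,_) (m ,_) (cover s (proj₁ (into s F m))) }) ,
         to (ih₁ _ _ (corr-restrict S₁ R S₁⊆)) a₁ , to (ih₂ _ _ (corr-restrict S₂ R S₂⊆)) a₂ })
    (λ { (T₁ , T₂ , lift (T₁⊆ , T₂⊆ , cover) , b₁ , b₂) →
         assignments T₁ , assignments T₂ ,
         lift ((λ { s (F , m) → proj₁ (into s F (T₁⊆ _ m)) }) ,
               (λ { s (F , m) → proj₁ (into s F (T₂⊆ _ m)) }) ,
               λ s m* → let (F , m) = onto s m* in map (F ,_) (F ,_) (cover (s , F) m)) ,
         from (ih₁ _ _ (corr-subteam T₁ R T₁⊆)) b₁ , from (ih₂ _ _ (corr-subteam T₂ R T₂⊆)) b₂ })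
    where
    part : CTeam σ → GTeam σ
    part S q = T q × S (proj₁ q)

  -- Transfer theorem: corresponding teams satisfy the same formulas, first for CO
  -- (negation only applies to CO-formulas), then for CO⊔.
  transfer-CO : ∀ α G T* T → Corr G T* T → satCO σ G T* α ⇔ satCOg σ T α
  transfer-CO (eqC X x)  G T* T R = transfer-all R (λ s → get s X ≡ x)
  transfer-CO (negC α)   G T* T R = transfer-neg (λ s F good → transfer-CO α G _ _ (corr-singleton good)) R
  transfer-CO (andC α β) G T* T R = transfer-CO α G T* T R ×-⇔ transfer-CO β G T* T R
  transfer-CO (orC α β)  G T* T R = transfer-split (transfer-CO α G) (transfer-CO β G) R
  transfer-CO (cfC xs α) G T* T R = ⇔-id _ ⊎-⇔ transfer-CO α _ _ _ (corr-intervention R)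

  transfer-C : ∀ φ G T* T → Corr G T* T → satC σ G T* φ ⇔ satG σ T φ
  transfer-C (eq X x)  G T* T R = transfer-all R (λ s → get s X ≡ x)
  transfer-C (neg α)   G T* T R = transfer-neg (λ s F good → transfer-CO α G _ _ (corr-singleton good)) R
  transfer-C (and φ ψ) G T* T R = transfer-C φ G T* T R ×-⇔ transfer-C ψ G T* T R
  transfer-C (or φ ψ)  G T* T R = transfer-split (transfer-C φ G) (transfer-C ψ G) R
  transfer-C (sq φ ψ)  G T* T R = transfer-C φ G T* T R ⊎-⇔ transfer-C ψ G T* T R
  transfer-C (cf xs φ) G T* T R = ⇔-id _ ⊎-⇔ transfer-C φ _ _ _ (corr-intervention R)

  empty-satisfies : (T : GTeam σ) → (∀ q → ¬ T q) → ∀ φ → satG σ T φ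
  empty-satisfies T empty (eq X x)  = lift (λ s F m → ⊥-elim (empty _ m))
  empty-satisfies T empty (neg α)   = λ s F m → ⊥-elim (empty _ m)
  empty-satisfies T empty (and φ ψ) = empty-satisfies T empty φ , empty-satisfies T empty ψ
  empty-satisfies T empty (or φ ψ)  =
    T , T , lift ((λ q m → m) , (λ q m → m) , (λ q m → inj₁ m)) ,
    empty-satisfies T empty φ , empty-satisfies T empty ψ
  empty-satisfies T empty (sq φ ψ)  = inj₁ (empty-satisfies T empty φ)
  empty-satisfies T empty (cf xs φ) =
    inj₂ (empty-satisfies (imgG σ xs T) (λ { _ (s , F , m , _) → empty _ m }) φ)

  dependsOn : FunAt σ V → Var σ → Bool
  dependsOn fa Y = not ⌊ Indep? (eval fa) Y ⌋

  dependsOn-sound : (fa : FunAt σ V) → dependsOn fa Y ≡ true → ¬ Indep (eval fa) Y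
  dependsOn-sound {Y = Y} fa e ind with Indep? (eval fa) Y
  dependsOn-sound fa () ind | yes _
  ... | no ¬ind = ¬ind ind

  dependsOn-complete : (fa : FunAt σ V) → ¬ Indep (eval fa) Y → dependsOn fa Y ≡ true
  dependsOn-complete {Y = Y} fa ¬ind with Indep? (eval fa) Y
  ... | yes ind = ⊥-elim (¬ind ind)
  ... | no _    = refl

  Reduced : FunAt σ V → Set
  Reduced fa = ∀ X → X ∈ pa fa → ¬ Indep (eval fa) X

  reduce : FunAt σ V → FunAt σ V
  reduce fa = record
    { pa  = tabulate (dependsOn fa)
    ; irr = λ V∈ → dependsOn-sound fa (∈-tabulate⁻ (dependsOn fa) V∈) (λ u a → sym (eval-set-self fa u a))
    ; fn  = λ p → eval fa (fill (tabulate (dependsOn fa)) p)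
    }

  -- Reducing keeps the function: the filled-in tuple agrees with u on every genuine argument.
  eval-reduce : (fa : FunAt σ V) → ∀ u → eval (reduce fa) u ≡ eval fa u
  eval-reduce fa u = agree-on-dependent (eval fa) _ u genuine
    where
    genuine : ∀ Y → Indep (eval fa) Y ⊎
              get (fill {rs σ} (tabulate (dependsOn fa)) (restr {rs σ} (tabulate (dependsOn fa)) u)) Y ≡ get u Y
    genuine Y with Indep? (eval fa) Y
    ... | yes ind = inj₁ ind
    ... | no ¬ind = inj₂ (get-fill {rs σ} _ u Y (∈-tabulate⁺ (dependsOn fa) (dependsOn-complete fa ¬ind)))

  reduce-reduced : (fa : FunAt σ V) → Reduced (reduce fa)
  reduce-reduced fa X X∈ ind = dependsOn-sound fa (∈-tabulate⁻ (dependsOn fa) X∈)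
    (λ u a → trans (sym (eval-reduce fa u)) (trans (ind u a) (eval-reduce fa (set u X a))))

  minimiseAt : Maybe (FunAt σ V) → Maybe (FunAt σ V)
  minimiseAt nothing   = nothing
  minimiseAt (just fa) = just (reduce fa)

  minimise : Sys σ → Sys σ
  minimise F V = minimiseAt (F V)

  minimise-reduced : (m : Maybe (FunAt σ V)) → ∀ {fa} → minimiseAt m ≡ just fa → Reduced fa
  minimise-reduced (just fa) refl = reduce-reduced fa

  edge? : (F : Sys σ) → ∀ X Y → Dec (Edge σ F X Y)
  edge? F X Y with F Y
  ... | nothing = no (λ { (fa , () , _) })
  ... | just fa with X ∈? pa fa
  ...   | yes X∈ = yes (fa , refl , X∈)
  ...   | no X∉  = no (λ { (_ , refl , X∈) → X∉ X∈ })

  -- The value V takes from s when all other variables are set as in u, if m is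
  -- the mechanism of V.
  response : Maybe (FunAt σ V) → Assign σ → Assign σ → Val σ V
  response {V} nothing   s u = get s V
  response     (just fa) s u = eval fa u

  response-minimise : (m : Maybe (FunAt σ V)) → ∀ s u → response (minimiseAt m) s u ≡ response m s u
  response-minimise nothing   s u = refl
  response-minimise (just fa) s u = eval-reduce fa u

  response-intervention : ∀ F s V u → IsIntv σ F s (others σ V u) (set u V (response (F V) s u))
  response-intervention F s V u = set-vars , free-vars
    where
    response-clause : (m : Maybe (FunAt σ V)) → IntvAt m s (set u V (response m s u))
    response-clause nothing   = (λ _ → get-set-same u V _) , λ _ ()
    response-clause (just fa) =
      (λ ()) , λ { _ refl → trans (get-set-same u V _) (sym (eval-set-self fa u _)) }
    set-vars : ∀ X x → (X , x) List.∈ others σ V u → get (set u V (response (F V) s u)) X ≡ x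
    set-vars X x mem with others-member {V = V} {u = u} mem
    ... | X≢V , refl = get-set-other u V _ X (λ e → X≢V (sym e))
    free-vars : ∀ Y → inDom σ Y (others σ V u) ≡ false → IntvAt (F Y) s (set u V (response (F V) s u))
    free-vars Y free with others-free-only V u Y free
    ... | refl = response-clause (F V)

  agree-from-response : (m m' : Maybe (FunAt σ V)) → (∀ u → response m s u ≡ response m' s u) → AgreeAt m m'
  agree-from-response nothing  nothing  same = tt
  agree-from-response (just a) (just b) same = same
  agree-from-response nothing  (just b) same = λ u u' → trans (sym (same u)) (same u')
  agree-from-response (just a) nothing  same = λ u u' → trans (same u) (sym (same u'))

  compat-from-response : (m m' : Maybe (FunAt σ V)) → (∀ u → response m s u ≡ response m' s u) →
                         CompatAt m s → CompatAt m' s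
  compat-from-response {s = s} nothing  (just b) same c _ refl = same s
  compat-from-response {s = s} (just a) (just b) same c _ refl = trans (c a refl) (same s)

  parent-from-response : (fa : FunAt σ V) (m' : Maybe (FunAt σ V)) → (∀ u → eval fa u ≡ response m' s u) →
                         ¬ Indep (eval fa) X → Σ (FunAt σ V) λ fa' → m' ≡ just fa' × X ∈ pa fa'
  parent-from-response {X = X} fa nothing same dep =
    ⊥-elim (dep λ u a → trans (same u) (sym (same (set u X a))))
  parent-from-response {X = X} fa (just fa') same dep with X ∈? pa fa'
  ... | yes X∈ = fa' , refl , X∈
  ... | no X∉  = ⊥-elim (dep λ u a → trans (same u) (trans (eval-indep fa' X∉ u a) (sym (same (set u X a)))))

  unchanged : (m : Maybe (FunAt σ V)) → (m ≡ nothing ⊎ Σ (FunAt σ V) λ fa → m ≡ just fa × Constant σ fa) →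
              CompatAt m s → IntvAt m s t → get t V ≡ get s V
  unchanged m (inj₁ e)                c (kept , _)    = kept e
  unchanged m (inj₂ (fa , e , const)) c (_ , follows) =
    trans (follows fa e) (trans (const _ _) (sym (c fa e)))

  -- (⇐) A causal team viewed as a generalized team satisfies Φ^F

  generalize : Sys σ → CTeam σ → GTeam σ
  generalize F T* q = T* (proj₁ q) × proj₂ q ≡ F

  corr-generalize : (∀ s → T* s → Compatible σ F s) → Corr F T* (generalize F T*)
  corr-generalize {F = F} compat =
    (λ { s _ (m , refl) → m , compat s m , compat s m , λ V → agreeAt-refl (F V) }) ,
    (λ s m → F , m , refl)

  -- ... and satisfies Φ^F: η since F computes V from its parents, ξ since an absent
  -- or constant mechanism leaves V unchanged.
  generalize-Phi : (∀ s → T* s → Compatible σ F s) → SatPhiG σ F (generalize F T*)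
  generalize-Phi {T* = T*} {F = F} compat V = η , ξ
    where
    η : ∀ fa → F V ≡ just fa → ∀ u → satG σ (generalize F T*) (etaConj σ V fa u)
    η fa eF u = inj₂ (lift λ { t _ (s , _ , (m , refl) , _ , iv) →
      trans (proj₂ (proj₂ iv V (others-free-self V u)) fa eF) (eval-after-others fa iv) })

    ξ : (F V ≡ nothing ⊎ Σ (FunAt σ V) λ fa → F V ≡ just fa × Constant σ fa) →
        ∀ v u → satG σ (generalize F T*) (xiConj σ V v u)
    ξ inert v u = T≢ , T≡ , lift ((λ _ → proj₁) , (λ _ → proj₁) , cover) , differs , keeps
      where
      T≢ T≡ : GTeam σ
      T≢ q = generalize F T* q × ¬ get (proj₁ q) V ≡ v
      T≡ q = generalize F T* q × get (proj₁ q) V ≡ v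
      cover : ∀ q → generalize F T* q → T≢ q ⊎ T≡ q
      cover q m with get (proj₁ q) V ≟ v
      ... | yes e  = inj₂ (m , e)
      ... | no V≢v = inj₁ (m , V≢v)
      differs : satG σ T≢ (neg (eqC V v))
      differs s F' (_ , V≢v) (lift h) = V≢v (h s F' refl)
      keeps : satG σ T≡ (cf (others σ V u) (eq V v))
      keeps = inj₂ (lift λ { t _ (s , _ , ((m , refl) , e) , _ , iv) →
        trans (unchanged (F V) inert (compat s m V) (proj₂ iv V (others-free-self V u))) e })

  -- Transfer Γ to the generalization, apply the generalized entailment, transfer ψ back.
  generalized⇒causal : (Γ : COsq σ → Set) (ψ : COsq σ) → EntGPhi σ Γ ψ → EntC σ Γ ψ
  generalized⇒causal Γ ψ ent F T* (recursive , compat) Γ-holds =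
    from (transfer-C ψ F T* _ R)
      (ent (generalize F T*) generalized (λ γ γ∈Γ → to (transfer-C γ F T* _ R) (Γ-holds γ γ∈Γ))
           (F , generalize-Phi compat))
    where
    R : Corr F T* (generalize F T*)
    R = corr-generalize compat
    generalized : IsGenTeam σ (generalize F T*)
    generalized = λ { s _ (m , refl) → recursive , compat s m }

  -- (⇒) Members of a team satisfying Φ^F

  forced-response : ∀ {v} → satG σ T (cf (others σ V u) (eq V v)) →
                    ∀ {s F} → T (s , F) → response (F V) s u ≡ v
  forced-response {V = V} {u = u} (inj₁ (lift inconsistent)) m =
    ⊥-elim (inconsistent (others-consistent V u))
  forced-response {V = V} {u = u} (inj₂ (lift h)) {s} {F} m =
    trans (sym (get-set-same u V _)) (h _ _ (s , F , m , refl , response-intervention F s V u))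

  member-response : SatPhiG σ F T → ∀ {s F'} → T (s , F') →
                    ∀ V u → response (F' V) s u ≡ response (F V) s u
  member-response {F = F} phi {s} {F'} m V u with F V in eF
  ... | just fa = forced-response (proj₁ (phi V) fa eF u) m
  ... | nothing with proj₂ (phi V) (inj₁ eF) (get s V) u
  ...   | _ , _ , lift (_ , _ , cover) , differs , keeps with cover (s , F') m
  ...     | inj₁ m≢ = ⊥-elim (differs s F' m≢ (lift λ { _ _ refl → refl }))
  ...     | inj₂ m≡ = forced-response keeps m≡

  member-good : SatPhiG σ F T → ∀ {s F'} → T (s , F') → Compatible σ F' s → Good s F' (minimise F)
  member-good {F = F} phi {s} {F'} m compat =
    compat , (λ V → compat-from-response (F' V) (minimise F V) (same V) (compat V)) ,
    (λ V → agree-from-response (F' V) (minimise F V) (same V))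
    where
    same : ∀ V u → response (F' V) s u ≡ response (minimise F V) s u
    same V u = trans (member-response phi m V u) (sym (response-minimise (F V) s u))

  member-edge : SatPhiG σ F T → ∀ {s F'} → T (s , F') → Edge σ (minimise F) X Y → Edge σ F' X Y
  member-edge {F = F} {Y = Y} phi {s} {F'} m (fa , e , X∈) =
    parent-from-response fa (F' Y)
      (λ u → trans (cong (λ m → response m s u) (sym e))
                   (trans (response-minimise (F Y) s u) (sym (member-response phi m Y u))))
      (minimise-reduced (F Y) e _ X∈)

  -- Decide whether F₀ is recursive; either transfer through (F₀ , T⁻) or T is empty.
  causal⇒generalized : (Γ : COsq σ → Set) (ψ : COsq σ) → EntC σ Γ ψ → EntGPhi σ Γ ψ
  causal⇒generalized Γ ψ ent T gen Γ-holds (F , phi) =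
    either via-causal-team empty (Acyclicity.acyclic? (Edge σ (minimise F)) (edge? (minimise F)))
    where
    good : ∀ s F' → T (s , F') → Good s F' (minimise F)
    good s F' m = member-good phi m (proj₂ (gen s F' m))
    R : Corr (minimise F) (assignments T) T
    R = (λ s F' m → (F' , m) , good s F' m) , (λ s m → m)
    via-causal-team : Recursive σ (minimise F) → satG σ T ψ
    via-causal-team recursive =
      to (transfer-C ψ _ _ _ R)
        (ent (minimise F) (assignments T) (recursive , λ { s (F' , m) → proj₁ (proj₂ (good s F' m)) })
             (λ γ γ∈Γ → from (transfer-C γ _ _ _ R) (Γ-holds γ γ∈Γ)))
    -- a cycle of F₀ is a cycle of every member, so T is empty
    empty : (Σ (Var σ) λ X → TransClosure (Edge σ (minimise F)) X X) → satG σ T ψ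
    empty (X , cycle) =
      empty-satisfies T (λ { (s , F') m → proj₁ (gen s F' m) X (tc-map (member-edge phi m) cycle) }) ψ

lemma5p8 : (σ : Sig) (Γ : COsq σ → Set) (ψ : COsq σ) →
           EntC σ Γ ψ ⇔ EntGPhi σ Γ ψ
lemma5p8 σ Γ ψ = mk⇔ (causal⇒generalized σ Γ ψ) (generalized⇒causal σ Γ ψ)
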